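{- For $m\in\{4,5\}$, \[ \gamma^{\mathrm{SID}}(K_m\times P_n)=\begin{cases}2m+6,& n=5,\\ 4m,& n=6.\end{cases} \]
   Context: For a vertex $v$, $N[v]$ is its closed neighborhood. A nonempty set $S\subseteq V(G)$ is a self-identifying code of $G$ if for every vertex $v\in V(G)$: (1) $N[v]\cap S\neq\emptyset$, and (2) $\bigcap_{c\in N[v]\cap S}N[c]=\{v\}$; $\gamma^{\mathrm{SID}}(G)$ is the minimum size of such a code. With $V(K_m)=\{v_0,\dots,v_{m-1}\}$ and $V(P_n)=\{0,\dots,n-1\}$ (consecutively numbered path), the direct product $K_m\times P_n$ has vertices $(v_i,j)$, with $(v_i,j)$ adjacent to $(v_{i'},j')$ iff $i\neq i'$ and $|j-j'|=1$. -}

module Defs where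

open import Data.Nat using (ℕ; suc; _≤_)
open import Data.Fin using (Fin; toℕ)
open import Data.Bool using (Bool; true; false)
open import Data.List using (List; allFin; cartesianProduct; filter; length)
open import Data.Product using (_×_; _,_; Σ; ∃; ∃-syntax)
open import Data.Sum using (_⊎_)
open import Relation.Binary.PropositionalEquality using (_≡_)
open import Relation.Nullary using (¬_)
open import Data.Bool.Properties using (T?)

module _ {V : Set} (Adj : V → V → Set) where

  _∈N[_] : V → V → Set
  u ∈N[ v ] = u ≡ v ⊎ Adj v u

  _∈S_ : V → (V → Bool) → Set
  c ∈S S = S c ≡ true

  InInter : (V → Bool) → V → V → Set
  InInter S v u = ∀ c → c ∈S S → c ∈N[ v ] → u ∈N[ c ]

  IsSID : (V → Bool) → Set
  IsSID S =
    (∃[ c ] c ∈S S) ×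
    (∀ v → (∃[ c ] (c ∈S S × c ∈N[ v ])) ×
           (InInter S v v × (∀ u → InInter S v u → u ≡ v)))

-- The direct product K_m × P_n, vertices (v_i , j) = (i , j).
AdjKP : (m n : ℕ) → Fin m × Fin n → Fin m × Fin n → Set
AdjKP m n (i , j) (i' , j') =
  ¬ (i ≡ i') × (toℕ j' ≡ suc (toℕ j) ⊎ toℕ j ≡ suc (toℕ j'))

verticesKP : (m n : ℕ) → List (Fin m × Fin n)
verticesKP m n = cartesianProduct (allFin m) (allFin n)

sizeKP : (m n : ℕ) → (Fin m × Fin n → Bool) → ℕ
sizeKP m n S = length (filter (λ x → T? (S x)) (verticesKP m n))

γSID-KP≡ : (m n k : ℕ) → Set
γSID-KP≡ m n k =
  (Σ (Fin m × Fin n → Bool) λ S → IsSID (AdjKP m n) S × sizeKP m n S ≡ k) ×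
  (∀ S → IsSID (AdjKP m n) S → k ≤ sizeKP m n S)

-- Let column j be the set of rows i with (v_i , j) ∈ S. Comparing the code neighbourhoods of
-- two suitable vertices shows: an end column is full (else (v_i , 0) and (v_i , 2) are not
-- separated); the column next to an end is contained in no pair {v_i , v_k}, so has at least
-- three elements; and if (v_i , j) ∉ S for an inner j, every other row k has (v_k , j - 1) or
-- (v_k , j + 1) in S. For n = 5 this gives 2m + 6 directly. For n = 6 each of the two middle
-- columns either misses at most one row or makes its two neighbouring columns cover every row;
-- with m ≤ 5 each alternative leaves at least 2m elements in the four inner columns. The upper
-- bounds are explicit codes, checked by evaluation.
module Submission where

open import Defs
open import Data.Bool using (Bool; true; false; if_then_else_)
open import Data.Bool.Properties using (T?) renaming (_≟_ to _≟ᵇ_)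
open import Data.Fin using (Fin; zero; suc; toℕ; fromℕ; inject₁; #_; _≟_)
open import Data.Fin.Properties
  using (all?; any?; toℕ-injective; toℕ-fromℕ; toℕ-inject₁; toℕ<n; suc-injective)
open import Data.Fin.Subset
  using (Subset; inside; outside; _∈_; _∉_; _∪_; ⊤; ⊥; ⁅_⁆; ∁; ∣_∣; _-_)
open import Data.Fin.Subset.Properties
  using (_∈?_; ∣⊤∣≡n; p⊆q⇒∣p∣≤∣q∣; ∣p∣≤∣x∷p∣; x∈p⇒∣p-x∣<∣p∣; x∈p∧x≢y⇒x∈p-y; x∈p∪q⁺; drop-there)
open import Data.List as List
  using (List; []; _∷_; allFin; cartesianProduct; filter; length; map; _++_)
open import Data.List.Properties using (map-++; map-∘; map-cong; map-tabulate)
open import Data.Nat using (ℕ; zero; suc; pred; _+_; _*_; _≤_; z≤n; s≤s)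
  renaming (_≟_ to _≟ℕ_)
open import Data.Nat.ListAction using (sum)
open import Data.Nat.ListAction.Properties using (sum-++)
open import Data.Nat.Properties
  using ( ≤-refl; ≤-trans; +-mono-≤; +-monoʳ-≤; +-suc; +-assoc; m≤m+n; m≤n+m; <⇒≢; n≤1+n
        ; +-commutativeSemigroup; module ≤-Reasoning)
open import Data.Nat.Tactic.RingSolver using (solve-∀)
open import Algebra.Properties.CommutativeSemigroup +-commutativeSemigroup using (interchange)
open import Data.Product using (Σ; ∃; ∃₂; _×_; _,_; proj₁; proj₂)
open import Data.Product.Properties using (≡-dec)
open import Data.Sum as Sum using (_⊎_; inj₁; inj₂)
open import Data.Vec using (Vec; []; _∷_; lookup; tabulate)
open import Data.Vec.Properties using (lookup∘tabulate; lookup⇒[]=)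
open import Function using (_∘_)
open import Relation.Nullary using (Dec; yes; no; contradiction)
open import Relation.Nullary.Decidable
  using (True; toWitness; map′; decidable-stable; _×-dec_; _⊎-dec_; _→-dec_; ¬?)
open import Relation.Binary.PropositionalEquality

private
  variable
    m n : ℕ

all∈⇒n≤∣p∣ : {p : Subset n} → (∀ x → x ∈ p) → n ≤ ∣ p ∣
all∈⇒n≤∣p∣ {n} {p} all∈ = subst (_≤ ∣ p ∣) (∣⊤∣≡n n) (p⊆q⇒∣p∣≤∣q∣ {p = ⊤} (λ {x} _ → all∈ x))

∣p∪q∣≤∣p∣+∣q∣ : (p q : Subset n) → ∣ p ∪ q ∣ ≤ ∣ p ∣ + ∣ q ∣
∣p∪q∣≤∣p∣+∣q∣ []            []            = z≤n
∣p∪q∣≤∣p∣+∣q∣ (outside ∷ p) (outside ∷ q) = ∣p∪q∣≤∣p∣+∣q∣ p q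
∣p∪q∣≤∣p∣+∣q∣ (outside ∷ p) (inside  ∷ q) =
  subst (suc ∣ p ∪ q ∣ ≤_) (sym (+-suc ∣ p ∣ ∣ q ∣)) (s≤s (∣p∪q∣≤∣p∣+∣q∣ p q))
∣p∪q∣≤∣p∣+∣q∣ (inside  ∷ p) (s       ∷ q) =
  s≤s (≤-trans (∣p∪q∣≤∣p∣+∣q∣ p q) (+-monoʳ-≤ ∣ p ∣ (∣p∣≤∣x∷p∣ s q)))

three-members⇒3≤∣p∣ : {p : Subset n} {x y z : Fin n} →
  x ∈ p → y ∈ p → z ∈ p → x ≢ y → x ≢ z → y ≢ z → 3 ≤ ∣ p ∣
three-members⇒3≤∣p∣ {p = p} {x} {y} {z} x∈p y∈p z∈p x≢y x≢z y≢z =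
  ≤-trans (s≤s 2≤∣p-x∣) (x∈p⇒∣p-x∣<∣p∣ x∈p)
  where
  y∈p-x : y ∈ p - x
  y∈p-x = x∈p∧x≢y⇒x∈p-y y∈p (x≢y ∘ sym)
  z∈p-x-y : z ∈ p - x - y
  z∈p-x-y = x∈p∧x≢y⇒x∈p-y (x∈p∧x≢y⇒x∈p-y z∈p (x≢z ∘ sym)) (y≢z ∘ sym)
  1≤∣p-x-y∣ : 1 ≤ ∣ p - x - y ∣
  1≤∣p-x-y∣ = ≤-trans (s≤s z≤n) (x∈p⇒∣p-x∣<∣p∣ z∈p-x-y)
  2≤∣p-x∣ : 2 ≤ ∣ p - x ∣
  2≤∣p-x∣ = ≤-trans (s≤s 1≤∣p-x-y∣) (x∈p⇒∣p-x∣<∣p∣ y∈p-x)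

NotWithinAnyPair : Subset n → Set
NotWithinAnyPair p = ∀ {i k} → k ≢ i → ∃ λ x → x ≢ i × x ≢ k × x ∈ p

notWithinAnyPair⇒3≤∣p∣ : {p : Subset (suc (suc n))} → NotWithinAnyPair p → 3 ≤ ∣ p ∣
notWithinAnyPair⇒3≤∣p∣ avoids =
  let x , x≢0 , _   , x∈p = avoids {zero} {suc zero} λ ()
      y , y≢x , _   , y∈p = avoids {x} {zero} (x≢0 ∘ sym)
      z , z≢x , z≢y , z∈p = avoids {x} {y} y≢x
  in three-members⇒3≤∣p∣ x∈p y∈p z∈p (y≢x ∘ sym) (z≢x ∘ sym) (z≢y ∘ sym)

TwoOutside : Subset n → Set
TwoOutside p = ∃₂ λ x y → x ≢ y × x ∉ p × y ∉ p

two-outside⊎pred≤∣p∣ : (p : Subset n) → TwoOutside p ⊎ pred n ≤ ∣ p ∣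
two-outside⊎pred≤∣p∣ [] = inj₂ z≤n
two-outside⊎pred≤∣p∣ (inside ∷ p) = Sum.map shift pred≤⇒≤suc (two-outside⊎pred≤∣p∣ p)
  where
  shift : ∀ {s} → TwoOutside p → TwoOutside (s ∷ p)
  shift (x , y , x≢y , x∉p , y∉p) =
    suc x , suc y , x≢y ∘ suc-injective , x∉p ∘ drop-there , y∉p ∘ drop-there
  pred≤⇒≤suc : ∀ {k l} → pred k ≤ l → k ≤ suc l
  pred≤⇒≤suc {zero}  _ = z≤n
  pred≤⇒≤suc {suc k} k≤l = s≤s k≤l
two-outside⊎pred≤∣p∣ (outside ∷ p) with any? (λ x → ¬? (x ∈? p))
... | yes (x , x∉p) = inj₁ (zero , suc x , (λ ()) , (λ ()) , x∉p ∘ drop-there)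
... | no  none      = inj₂ (all∈⇒n≤∣p∣ λ x → decidable-stable (x ∈? p) (none ∘ (x ,_)))

pred≤∣p∣⊎n≤∣q∣+∣r∣ : {p q r : Subset n} → (∀ {i k} → i ∉ p → k ≢ i → k ∈ q ∪ r) →
  pred n ≤ ∣ p ∣ ⊎ n ≤ ∣ q ∣ + ∣ r ∣
pred≤∣p∣⊎n≤∣q∣+∣r∣ {p = p} {q} {r} covers with two-outside⊎pred≤∣p∣ p
... | inj₂ pred≤∣p∣ = inj₁ pred≤∣p∣
... | inj₁ (x , y , x≢y , x∉p , y∉p) = inj₂ (≤-trans (all∈⇒n≤∣p∣ covered) (∣p∪q∣≤∣p∣+∣q∣ q r))
  where
  covered : ∀ k → k ∈ q ∪ r
  covered k with k ≟ x
  ... | yes refl = covers y∉p x≢y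
  ... | no  k≢x  = covers x∉p k≢x

double≤3+pred+3 : {m : ℕ} → m ≤ 5 → m + m ≤ 3 + (pred m + 3)
double≤3+pred+3 {zero}  _          = z≤n
double≤3+pred+3 {suc k} (s≤s k≤4) =
  subst₂ _≤_ (cong suc (sym (+-suc k k))) (cong (2 +_) (+-suc k 3)) (s≤s (s≤s (+-monoʳ-≤ k k≤4)))

middle-bound : ∀ {m a b c d} → m ≤ 5 → 3 ≤ a → 3 ≤ d →
  pred m ≤ b ⊎ m ≤ a + c → pred m ≤ c ⊎ m ≤ b + d → m + m ≤ (a + b) + (c + d)
middle-bound {m} {a} {b} {c} {d} m≤5 3≤a 3≤d (inj₁ pred≤b) _ = begin
  m + m                  ≤⟨ double≤3+pred+3 m≤5 ⟩
  3 + (pred m + 3)       ≡⟨ +-assoc 3 (pred m) 3 ⟨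
  (3 + pred m) + 3       ≤⟨ +-mono-≤ (+-mono-≤ 3≤a pred≤b) (≤-trans 3≤d (m≤n+m d c)) ⟩
  (a + b) + (c + d)      ∎
  where open ≤-Reasoning
middle-bound {m} {a} {b} {c} {d} m≤5 3≤a 3≤d _ (inj₁ pred≤c) = begin
  m + m                  ≤⟨ double≤3+pred+3 m≤5 ⟩
  3 + (pred m + 3)       ≤⟨ +-mono-≤ (≤-trans 3≤a (m≤m+n a b)) (+-mono-≤ pred≤c 3≤d) ⟩
  (a + b) + (c + d)      ∎
  where open ≤-Reasoning
middle-bound {m} {a} {b} {c} {d} _ _ _ (inj₂ m≤a+c) (inj₂ m≤b+d) = begin
  m + m                  ≤⟨ +-mono-≤ m≤a+c m≤b+d ⟩
  (a + c) + (b + d)      ≡⟨ interchange a c b d ⟩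
  (a + b) + (c + d)      ∎
  where open ≤-Reasoning

PathAdj : Fin n → Fin n → Set
PathAdj j j' = toℕ j' ≡ suc (toℕ j) ⊎ toℕ j ≡ suc (toℕ j')

PathAdj? : (j j' : Fin n) → Dec (PathAdj j j')
PathAdj? j j' = toℕ j' ≟ℕ suc (toℕ j) ⊎-dec toℕ j ≟ℕ suc (toℕ j')

PathAdj-sym : {j j' : Fin n} → PathAdj j j' → PathAdj j' j
PathAdj-sym = Sum.swap

Pendant : Fin n → Fin n → Set
Pendant j j₁ = PathAdj j j₁ × (∀ j' → PathAdj j j' → j' ≡ j₁)

NeighboursIn : Fin n → Fin n → Fin n → Set
NeighboursIn j jₗ jᵣ = ∀ j' → PathAdj j j' → j' ≡ jₗ ⊎ j' ≡ jᵣ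

first-pendant : Pendant {suc (suc n)} zero (suc zero)
first-pendant = inj₁ refl , λ { j' (inj₁ j'≡1) → toℕ-injective j'≡1 ; j' (inj₂ ()) }

last-pendant : Pendant {suc (suc n)} (fromℕ (suc n)) (inject₁ (fromℕ n))
last-pendant {n} = inj₂ (cong suc (sym (toℕ-inject₁ (fromℕ n)))) , neighbour
  where
  neighbour : ∀ j' → PathAdj (fromℕ (suc n)) j' → j' ≡ inject₁ (fromℕ n)
  neighbour j' (inj₁ e) =
    contradiction (trans e (cong (λ k → suc (suc k)) (toℕ-fromℕ n))) (<⇒≢ (toℕ<n j'))
  neighbour j' (inj₂ e) = toℕ-injective (trans (cong pred (sym e)) (sym (toℕ-inject₁ (fromℕ n))))

inner-neighboursIn : {j jₗ jᵣ : Fin n} →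
  suc (toℕ jₗ) ≡ toℕ j → toℕ jᵣ ≡ suc (toℕ j) → NeighboursIn j jₗ jᵣ
inner-neighboursIn jₗ<j j<jᵣ j' (inj₁ e) = inj₂ (toℕ-injective (trans e (sym j<jᵣ)))
inner-neighboursIn jₗ<j j<jᵣ j' (inj₂ e) =
  inj₁ (toℕ-injective (cong pred (trans (sym e) (sym jₗ<j))))

column : (Fin m × Fin n → Bool) → Fin n → Subset m
column S j = tabulate λ i → S (i , j)

∈-column⁺ : (S : Fin m × Fin n → Bool) {i : Fin m} {j : Fin n} → S (i , j) ≡ true → i ∈ column S j
∈-column⁺ S {i} {j} Sij = lookup⇒[]= i (column S j) (trans (lookup∘tabulate _ i) Sij)

module SIDColumns {S : Fin m × Fin n → Bool} (sid : IsSID (AdjKP m n) S) where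

  private
    separates : ∀ v u → InInter (AdjKP m n) S v u → u ≡ v
    separates v = proj₂ (proj₂ (proj₂ sid v))

  pendant-column-full : ∀ {j j₁ j₂} → Pendant j j₁ → PathAdj j₁ j₂ → j₂ ≢ j → ∀ i → i ∈ column S j
  pendant-column-full {j} {j₁} {j₂} (_ , unique) j₁~j₂ j₂≢j i with i ∈? column S j
  ... | yes i∈ = i∈
  ... | no  i∉ = contradiction (cong proj₂ (separates (i , j) (i , j₂) twin)) j₂≢j
    where
    twin : InInter (AdjKP m n) S (i , j) (i , j₂)
    twin _        c∈S (inj₁ refl)        = contradiction (∈-column⁺ S c∈S) i∉
    twin (i' , j') _   (inj₂ (i≢i' , j~j')) with refl ← unique j' j~j' = inj₂ (i≢i' ∘ sym , j₁~j₂)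

  pendant-neighbour-notWithinAnyPair : ∀ {j j₁} → Pendant j j₁ → NotWithinAnyPair (column S j₁)
  pendant-neighbour-notWithinAnyPair {j} {j₁} (j~j₁ , unique) {i} {k} k≢i
    with any? (λ x → ¬? (x ≟ i) ×-dec ¬? (x ≟ k) ×-dec x ∈? column S j₁)
  ... | yes found = found
  ... | no  none  = contradiction (cong proj₁ (separates (i , j) (k , j₁) twin)) k≢i
    where
    twin : InInter (AdjKP m n) S (i , j) (k , j₁)
    twin _        _   (inj₁ refl)          = inj₂ (k≢i ∘ sym , j~j₁)
    twin (i' , j') c∈S (inj₂ (i≢i' , j~j')) with refl ← unique j' j~j' | i' ≟ k
    ... | yes refl = inj₁ refl
    ... | no  i'≢k = contradiction (i' , i≢i' ∘ sym , i'≢k , ∈-column⁺ S c∈S) none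

  outside-covered : ∀ {j jₗ jᵣ} → NeighboursIn j jₗ jᵣ →
    ∀ {i k} → i ∉ column S j → k ≢ i → k ∈ column S jₗ ∪ column S jᵣ
  outside-covered {j} {jₗ} {jᵣ} within {i} {k} i∉ k≢i with k ∈? column S jₗ ∪ column S jᵣ
  ... | yes k∈ = k∈
  ... | no  k∉ = contradiction (cong proj₁ (separates (i , j) (k , j) twin)) k≢i
    where
    twin : InInter (AdjKP m n) S (i , j) (k , j)
    twin _        c∈S (inj₁ refl)          = contradiction (∈-column⁺ S c∈S) i∉
    twin (i' , j') c∈S (inj₂ (i≢i' , j~j')) with i' ≟ k
    ... | no  i'≢k = inj₂ (i'≢k , PathAdj-sym j~j')
    ... | yes refl = contradiction (x∈p∪q⁺ (Sum.map k∈column k∈column (within j' j~j'))) k∉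
      where
      k∈column : ∀ {j''} → j' ≡ j'' → k ∈ column S j''
      k∈column refl = ∈-column⁺ S c∈S

indicator : Bool → ℕ
indicator b = if b then 1 else 0

length-filter : ∀ {A : Set} (f : A → Bool) (xs : List A) →
  length (filter (T? ∘ f) xs) ≡ sum (map (indicator ∘ f) xs)
length-filter f []       = refl
length-filter f (x ∷ xs) with f x
... | true  = cong suc (length-filter f xs)
... | false = length-filter f xs

sum-map-+ : ∀ {A : Set} (f g : A → ℕ) (xs : List A) →
  sum (map (λ x → f x + g x) xs) ≡ sum (map f xs) + sum (map g xs)
sum-map-+ f g []       = refl
sum-map-+ f g (x ∷ xs) =
  trans (cong (f x + g x +_) (sum-map-+ f g xs)) (interchange (f x) (g x) _ _)

sum-cartesianProduct : ∀ {A B : Set} (h : A × B → ℕ) (xs : List A) (ys : List B) →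
  sum (map h (cartesianProduct xs ys)) ≡ sum (map (λ y → sum (map (λ x → h (x , y)) xs)) ys)
sum-cartesianProduct h []       ys = sym (sum-map-zero ys)
  where
  sum-map-zero : ∀ {B : Set} (ys : List B) → sum (map (λ _ → 0) ys) ≡ 0
  sum-map-zero []       = refl
  sum-map-zero (_ ∷ ys) = sum-map-zero ys
sum-cartesianProduct h (x ∷ xs) ys = begin
  sum (map h (map (x ,_) ys ++ cartesianProduct xs ys))
    ≡⟨ cong sum (map-++ h (map (x ,_) ys) (cartesianProduct xs ys)) ⟩
  sum (map h (map (x ,_) ys) ++ map h (cartesianProduct xs ys))
    ≡⟨ sum-++ (map h (map (x ,_) ys)) _ ⟩
  sum (map h (map (x ,_) ys)) + sum (map h (cartesianProduct xs ys))
    ≡⟨ cong₂ _+_ (cong sum (sym (map-∘ ys))) (sum-cartesianProduct h xs ys) ⟩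
  sum (map (λ y → h (x , y)) ys) + sum (map (λ y → sum (map (λ x → h (x , y)) xs)) ys)
    ≡⟨ sum-map-+ (λ y → h (x , y)) (λ y → sum (map (λ x → h (x , y)) xs)) ys ⟨
  sum (map (λ y → sum (map (λ x → h (x , y)) (x ∷ xs))) ys)
    ∎
  where open ≡-Reasoning

∣tabulate∣ : (f : Fin n → Bool) → ∣ tabulate f ∣ ≡ sum (map (indicator ∘ f) (allFin n))
∣tabulate∣ {n} f = trans (∣tabulate∣′ f) (cong sum (sym (map-tabulate (λ i → i) (indicator ∘ f))))
  where
  ∣∷∣ : ∀ {k} b (p : Subset k) → ∣ b ∷ p ∣ ≡ indicator b + ∣ p ∣
  ∣∷∣ true  p = refl
  ∣∷∣ false p = refl
  ∣tabulate∣′ : ∀ {k} (f : Fin k → Bool) → ∣ tabulate f ∣ ≡ sum (List.tabulate (indicator ∘ f))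
  ∣tabulate∣′ {zero}  f = refl
  ∣tabulate∣′ {suc k} f =
    trans (∣∷∣ (f zero) (tabulate (f ∘ suc))) (cong (indicator (f zero) +_) (∣tabulate∣′ (f ∘ suc)))

sizeKP≡sum-∣column∣ : (S : Fin m × Fin n → Bool) →
  sizeKP m n S ≡ sum (map (∣_∣ ∘ column S) (allFin n))
sizeKP≡sum-∣column∣ {m} {n} S = begin
  sizeKP m n S
    ≡⟨ length-filter S (verticesKP m n) ⟩
  sum (map (indicator ∘ S) (cartesianProduct (allFin m) (allFin n)))
    ≡⟨ sum-cartesianProduct (indicator ∘ S) (allFin m) (allFin n) ⟩
  sum (map (λ j → sum (map (λ i → indicator (S (i , j))) (allFin m))) (allFin n))
    ≡⟨ cong sum (map-cong (λ j → sym (∣tabulate∣ (λ i → S (i , j)))) (allFin n)) ⟩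
  sum (map (∣_∣ ∘ column S) (allFin n))
    ∎
  where open ≡-Reasoning

lower-bound-P5 : 2 ≤ m → ∀ S → IsSID (AdjKP m 5) S → 2 * m + 6 ≤ sizeKP m 5 S
lower-bound-P5 {m@(suc (suc _))} (s≤s (s≤s z≤n)) S sid = begin
  2 * m + 6
    ≡⟨ regroup m ⟩
  m + (3 + (0 + (3 + (m + 0))))
    ≤⟨ +-mono-≤ end₀ (+-mono-≤ next₁ (+-mono-≤ (z≤n {c (# 2)}) (+-mono-≤ next₃ (+-mono-≤ end₄ z≤n)))) ⟩
  c (# 0) + (c (# 1) + (c (# 2) + (c (# 3) + (c (# 4) + 0))))
    ≡⟨ sizeKP≡sum-∣column∣ S ⟨
  sizeKP m 5 S
    ∎
  where
  open ≤-Reasoning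
  open SIDColumns sid
  c : Fin 5 → ℕ
  c = ∣_∣ ∘ column S
  regroup : ∀ m → 2 * m + 6 ≡ m + (3 + (0 + (3 + (m + 0))))
  regroup = solve-∀
  end₀ : m ≤ c (# 0)
  end₀ = all∈⇒n≤∣p∣ (pendant-column-full first-pendant (inj₁ refl) λ ())
  end₄ : m ≤ c (# 4)
  end₄ = all∈⇒n≤∣p∣ (pendant-column-full last-pendant (inj₂ refl) λ ())
  next₁ : 3 ≤ c (# 1)
  next₁ = notWithinAnyPair⇒3≤∣p∣ (pendant-neighbour-notWithinAnyPair first-pendant)
  next₃ : 3 ≤ c (# 3)
  next₃ = notWithinAnyPair⇒3≤∣p∣ (pendant-neighbour-notWithinAnyPair last-pendant)

lower-bound-P6 : 2 ≤ m → m ≤ 5 → ∀ S → IsSID (AdjKP m 6) S → 4 * m ≤ sizeKP m 6 S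
lower-bound-P6 {m@(suc (suc _))} (s≤s (s≤s z≤n)) m≤5 S sid = begin
  4 * m
    ≡⟨ regroup m ⟩
  m + ((m + m) + (m + 0))
    ≤⟨ +-mono-≤ end₀ (+-mono-≤ middle (+-mono-≤ end₅ z≤n)) ⟩
  c (# 0) + ((c (# 1) + c (# 2)) + (c (# 3) + c (# 4)) + (c (# 5) + 0))
    ≡⟨ reassociate (c (# 0)) (c (# 1)) (c (# 2)) (c (# 3)) (c (# 4)) (c (# 5)) ⟩
  c (# 0) + (c (# 1) + (c (# 2) + (c (# 3) + (c (# 4) + (c (# 5) + 0)))))
    ≡⟨ sizeKP≡sum-∣column∣ S ⟨
  sizeKP m 6 S
    ∎
  where
  open ≤-Reasoning
  open SIDColumns sid
  c : Fin 6 → ℕ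
  c = ∣_∣ ∘ column S
  regroup : ∀ m → 4 * m ≡ m + ((m + m) + (m + 0))
  regroup = solve-∀
  reassociate : ∀ a b c d e f →
    a + ((b + c) + (d + e) + (f + 0)) ≡ a + (b + (c + (d + (e + (f + 0)))))
  reassociate = solve-∀
  end₀ : m ≤ c (# 0)
  end₀ = all∈⇒n≤∣p∣ (pendant-column-full first-pendant (inj₁ refl) λ ())
  end₅ : m ≤ c (# 5)
  end₅ = all∈⇒n≤∣p∣ (pendant-column-full last-pendant (inj₂ refl) λ ())
  middle : m + m ≤ (c (# 1) + c (# 2)) + (c (# 3) + c (# 4))
  middle = middle-bound m≤5 next₁ next₄ gap₂ gap₃
    where
    next₁ : 3 ≤ c (# 1)
    next₁ = notWithinAnyPair⇒3≤∣p∣ (pendant-neighbour-notWithinAnyPair first-pendant)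
    next₄ : 3 ≤ c (# 4)
    next₄ = notWithinAnyPair⇒3≤∣p∣ (pendant-neighbour-notWithinAnyPair last-pendant)
    gap₂ : pred m ≤ c (# 2) ⊎ m ≤ c (# 1) + c (# 3)
    gap₂ = pred≤∣p∣⊎n≤∣q∣+∣r∣ {q = column S (# 1)} {column S (# 3)}
             (outside-covered (inner-neighboursIn refl refl))
    gap₃ : pred m ≤ c (# 3) ⊎ m ≤ c (# 2) + c (# 4)
    gap₃ = pred≤∣p∣⊎n≤∣q∣+∣r∣ {q = column S (# 2)} {column S (# 4)}
             (outside-covered (inner-neighboursIn refl refl))

module _ {m n : ℕ} where

  all²? : {P : Fin m × Fin n → Set} → (∀ v → Dec (P v)) → Dec (∀ v → P v)
  all²? P? = map′ (λ all v → all (proj₁ v) (proj₂ v)) (λ all i j → all (i , j))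
                  (all? λ i → all? λ j → P? (i , j))

  any²? : {P : Fin m × Fin n → Set} → (∀ v → Dec (P v)) → Dec (∃ P)
  any²? P? = map′ (λ (i , j , p) → (i , j) , p) (λ ((i , j) , p) → i , j , p)
                  (any? λ i → any? λ j → P? (i , j))

  isSID? : (S : Fin m × Fin n → Bool) → Dec (IsSID (AdjKP m n) S)
  isSID? S = any²? (λ c → S c ≟ᵇ true)
    ×-dec all²? λ v → dominated? v ×-dec inInter? v v ×-dec all²? λ u → inInter? v u →-dec u ≟ᵥ v
    where
    _≟ᵥ_ : (u v : Fin m × Fin n) → Dec (u ≡ v)
    _≟ᵥ_ = ≡-dec _≟_ _≟_
    adj? : ∀ v u → Dec (AdjKP m n v u)
    adj? (i , j) (i' , j') = ¬? (i ≟ i') ×-dec PathAdj? j j'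
    ∈N? : ∀ u v → Dec (_∈N[_] (AdjKP m n) u v)
    ∈N? u v = u ≟ᵥ v ⊎-dec adj? v u
    inInter? : ∀ v u → Dec (InInter (AdjKP m n) S v u)
    inInter? v u = all²? λ c → (S c ≟ᵇ true) →-dec ∈N? c v →-dec ∈N? u c
    dominated? : ∀ v → Dec (∃ λ c → S c ≡ true × _∈N[_] (AdjKP m n) c v)
    dominated? v = any²? λ c → (S c ≟ᵇ true) ×-dec ∈N? c v

fromColumns : Vec (Subset m) n → Fin m × Fin n → Bool
fromColumns cs (i , j) = lookup (lookup cs j) i

checked-code : (cs : Vec (Subset m) n) → {True (isSID? (fromColumns cs))} →
  Σ (Fin m × Fin n → Bool) λ S → IsSID (AdjKP m n) S × sizeKP m n S ≡ sizeKP m n (fromColumns cs)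
checked-code cs {isSID} = fromColumns cs , toWitness isSID , refl

theoremA3 : (m : ℕ) → m ≡ 4 ⊎ m ≡ 5 →
    γSID-KP≡ m 5 (2 * m + 6) × γSID-KP≡ m 6 (4 * m)
theoremA3 _ (inj₁ refl) =
  (checked-code (⊤ ∷ ∁ ⁅3⁆ ∷ ⊥ ∷ ∁ ⁅2⁆ ∷ ⊤ ∷ []) , lower-bound-P5 2≤4) ,
  (checked-code (⊤ ∷ ∁ ⁅3⁆ ∷ ⁅3⁆ ∷ ⁅3⁆ ∷ ∁ ⁅3⁆ ∷ ⊤ ∷ []) , lower-bound-P6 2≤4 (n≤1+n 4))
  where
  2≤4 : 2 ≤ 4
  2≤4 = s≤s (s≤s z≤n)
  ⁅2⁆ ⁅3⁆ : Subset 4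
  ⁅2⁆ = ⁅ # 2 ⁆
  ⁅3⁆ = ⁅ # 3 ⁆
theoremA3 _ (inj₂ refl) =
  (checked-code (⊤ ∷ ∁ ⁅3,4⁆ ∷ ⊥ ∷ ∁ ⁅1,2⁆ ∷ ⊤ ∷ []) , lower-bound-P5 2≤5) ,
  (checked-code (⊤ ∷ ∁ ⁅3,4⁆ ∷ ⁅0,1⁆ ∷ ⁅3,4⁆ ∷ ∁ ⁅0,1⁆ ∷ ⊤ ∷ []) , lower-bound-P6 2≤5 ≤-refl)
  where
  2≤5 : 2 ≤ 5
  2≤5 = s≤s (s≤s z≤n)
  ⁅0,1⁆ ⁅1,2⁆ ⁅3,4⁆ : Subset 5
  ⁅0,1⁆ = ⁅ # 0 ⁆ ∪ ⁅ # 1 ⁆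
  ⁅1,2⁆ = ⁅ # 1 ⁆ ∪ ⁅ # 2 ⁆
  ⁅3,4⁆ = ⁅ # 3 ⁆ ∪ ⁅ # 4 ⁆
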